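{- In $\mathrm{Id}_\beta(W)[x,y]$ (with $W=W(X_n)$ of the appropriate type): (1) $A^{(n)}_i(x)A^{(n)}_i(y)=A^{(n)}_i(y)A^{(n)}_i(x)$ for $1\le i\le n-1$; (2) $F^X_n(x)F^X_n(y)=F^X_n(y)F^X_n(x)$ for $X=B,C,D$; (3) $F^X_n(x)F^X_n(\bar x)=1$ for $X=B,C,D$.
   Context: Let $\beta$ be an indeterminate, $x\oplus y=x+y+\beta xy$, $\bar x=-x/(1+\beta x)$. $W(B_n)=W(C_n)$ is generated by $s_0,s_1,\dots,s_{n-1}$ with $(s_0s_1)^4=1$, $(s_0s_i)^2=1$ ($i\ge2$) and type-$A$ relations among $s_1,\dots,s_{n-1}$; $W(D_n)$ is generated by $s_{\hat1}=s_0s_1s_0,s_1,\dots,s_{n-1}$. The IdCoxeter algebra $\mathrm{Id}_\beta(W)$ is the $\mathbb Z[\beta]$-algebra with generators $u_i$ (one per simple reflection), relations $u_i^2=\beta u_i$ and the braid relations ($m_{ij}$ factors, $m_{ij}$ the order of $s_is_j$). Variables commute with the $u_i$; $h_i(x)=1+xu_i$. $A^{(n)}_i(x)=h_{n-1}(x)h_{n-2}(x)\cdots h_i(x)$; $F^B_n(x)=h_{n-1}(x)\cdots h_1(x)h_0(x)h_1(x)\cdots h_{n-1}(x)$; $F^C_n(x)=h_{n-1}(x)\cdots h_1(x)h_0(x)^2h_1(x)\cdots h_{n-1}(x)$; $F^D_n(x)=h_{n-1}(x)\cdots h_2(x)h_1(x)h_{\hat1}(x)h_2(x)\cdots h_{n-1}(x)$.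 -}

module Defs where

open import Level using (_⊔_)
open import Algebra.Bundles using (Ring)
open import Data.Nat using (ℕ; zero; suc; _∸_; _≤_; _<_) renaming (_+_ to _+ℕ_)
open import Data.Product using (_×_)

-- Everything is stated in an arbitrary (associative, unital) ring R in which the
-- generators u_i satisfy the IdCoxeter relations and β, x, y are central.
-- (Identities in Id_β(W)[x,y] are exactly the identities valid in all such data.)
module _ {c ℓ} (R : Ring c ℓ) where
  open Ring R

  Central : Carrier → Set (c ⊔ ℓ)
  Central z = ∀ a → z * a ≈ a * z

  h : Carrier → Carrier → Carrier
  h x g = 1# + x * g

  desc : (ℕ → Carrier) → ℕ → ℕ → Carrier
  desc f i zero    = 1#
  desc f i (suc k) = f (i +ℕ k) * desc f i k

  asc : (ℕ → Carrier) → ℕ → ℕ → Carrier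
  asc f i zero    = 1#
  asc f i (suc k) = asc f i k * f (i +ℕ k)

  record IsIdA (β : Carrier) (n : ℕ) (u : ℕ → Carrier) : Set (c ⊔ ℓ) where
    field
      idemA  : ∀ i → 1 ≤ i → i < n → u i * u i ≈ β * u i
      commA  : ∀ i j → 1 ≤ i → 2 +ℕ i ≤ j → j < n → u i * u j ≈ u j * u i
      braidA : ∀ i → 1 ≤ i → 1 +ℕ i < n →
               u i * u (suc i) * u i ≈ u (suc i) * u i * u (suc i)

  -- Id_β(W(B_n)) = Id_β(W(C_n)): generators u_0,…,u_{n-1}
  record IsIdB (β : Carrier) (n : ℕ) (u : ℕ → Carrier) : Set (c ⊔ ℓ) where
    field
      isIdA   : IsIdA β n u
      idem0   : 0 < n → u 0 * u 0 ≈ β * u 0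
      braid01 : 1 < n → u 0 * u 1 * u 0 * u 1 ≈ u 1 * u 0 * u 1 * u 0
      comm0   : ∀ i → 2 ≤ i → i < n → u 0 * u i ≈ u i * u 0

  -- Id_β(W(D_n)): generators uh = u_{\hat 1}, u_1,…,u_{n-1}  (u 0 is unused)
  record IsIdD (β : Carrier) (n : ℕ) (u : ℕ → Carrier) (uh : Carrier) : Set (c ⊔ ℓ) where
    field
      isIdA   : IsIdA β n u
      idemh   : uh * uh ≈ β * uh
      commh1  : 1 < n → uh * u 1 ≈ u 1 * uh
      braidh2 : 2 < n → uh * u 2 * uh ≈ u 2 * uh * u 2
      commh   : ∀ i → 3 ≤ i → i < n → uh * u i ≈ u i * uh

  -- A^{(n)}_i(x) = h_{n-1}(x) ⋯ h_i(x)
  Aop : ℕ → ℕ → Carrier → (ℕ → Carrier) → Carrier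
  Aop n i x u = desc (λ j → h x (u j)) i (n ∸ i)

  -- F^B_n(x) = h_{n-1}⋯h_1 h_0 h_1⋯h_{n-1}
  FB : ℕ → Carrier → (ℕ → Carrier) → Carrier
  FB n x u = desc (λ j → h x (u j)) 1 (n ∸ 1) * h x (u 0)
             * asc (λ j → h x (u j)) 1 (n ∸ 1)

  -- F^C_n(x) = h_{n-1}⋯h_1 h_0^2 h_1⋯h_{n-1}
  FC : ℕ → Carrier → (ℕ → Carrier) → Carrier
  FC n x u = desc (λ j → h x (u j)) 1 (n ∸ 1) * h x (u 0) * h x (u 0)
             * asc (λ j → h x (u j)) 1 (n ∸ 1)

  -- F^D_n(x) = h_{n-1}⋯h_2 h_1 h_{\hat1} h_2⋯h_{n-1}
  FD : ℕ → Carrier → (ℕ → Carrier) → Carrier → Carrier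
  FD n x u uh = desc (λ j → h x (u j)) 2 (n ∸ 2) * h x (u 1) * h x uh
                * asc (λ j → h x (u j)) 2 (n ∸ 2)

  -- x̄ = -x/(1+βx) = -(x * w), where w is a two-sided inverse of 1 + βx
  IsInv1βx : Carrier → Carrier → Carrier → Set ℓ
  IsInv1βx β x w = ((1# + β * x) * w ≈ 1#) × (w * (1# + β * x) ≈ 1#)

-- All three parts go by induction on the number of generators, peeling off the outermost
-- factors; F^B, F^C, F^D are palindromes h_{n-1}⋯h_s z h_s⋯h_{n-1} around the cores h₀, h₀², h₁ĥ.
-- For a braid pair v, w the commutator δ = [w,v] satisfies h_x(v) δ = δ h_x(w) and δ² = 0.
-- This gives the Yang–Baxter equation and the factorisations
--   h_x(v) h_x(w) h_y(v) = Λ h_x(w),   h_x(v) h_y(w) h_y(v) = h_y(w) Λ′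
-- with Λ, Λ′ symmetric in x and y, whence A(x)A(y) = Λ A′(x)A′(y) and F(x)F(y) = Λ F′(x)F′(y) Λ′
-- for the products A′, F′ with one generator fewer; no inverse of h is needed.  In rank two, the
-- commutator of the B₂ palindromes h_x(u₁)h_p(u₀)h_x(u₁) is a scalar multiple of [u₁,u₀] whose
-- coefficient vanishes for p = x (type B) and p = x ⊕ x (type C) by a polynomial identity, and D₃
-- follows from the Yang–Baxter equation along u₁ – u₂ – û.  Part (3) telescopes, as
-- h_x(u) h_x̄(u) = h_{x ⊕ x̄}(u) = 1.

module Submission where

open import Defs
open import Algebra.Bundles using (Ring; CommutativeSemiring)
open import Data.Nat using (ℕ; zero; suc; _∸_; _≤_; _<_; z≤n; s≤s) renaming (_+_ to _+ℕ_)
open import Data.Nat.Properties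
  using (≤-refl; ≤-trans; <⇒≤; n≤1+n; m≤m+n; m<m+n; +-suc; +-monoʳ-≤; m<n⇒m<1+n; m+[n∸m]≡n)
  renaming (+-comm to +ℕ-comm; +-identityʳ to +ℕ-identityʳ)
import Relation.Binary.PropositionalEquality as P
open import Level using (_⊔_)
open import Data.Product using (Σ; _×_; _,_; proj₁; proj₂)
import Algebra.Solver.Monoid as MonoidSolver
import Algebra.Solver.CommutativeMonoid
import Relation.Binary.Construct.On as On

module InRing {r₁ r₂} (R : Ring r₁ r₂) where
  open Ring R
  open import Algebra.Properties.Ring R
  open import Relation.Binary.Reasoning.Setoid setoid

  open MonoidSolver *-monoid using (_⊜_) renaming (_⊕_ to _·_; solve to *-solve)
  open Algebra.Solver.CommutativeMonoid +-commutativeMonoid using () renaming (_⊕_ to _⊞_; _⊜_ to _⊜⁺_; solve to +-solve)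

  central-0 : Central R 0#
  central-0 a = trans (zeroˡ a) (sym (zeroʳ a))

  central-1 : Central R 1#
  central-1 a = trans (*-identityˡ a) (sym (*-identityʳ a))

  central-+ : ∀ {a b} → Central R a → Central R b → Central R (a + b)
  central-+ {a} {b} ca cb z = begin
    (a + b) * z     ≈⟨ distribʳ z a b ⟩
    a * z + b * z   ≈⟨ +-cong (ca z) (cb z) ⟩
    z * a + z * b   ≈⟨ distribˡ z a b ⟨
    z * (a + b)     ∎

  central-* : ∀ {a b} → Central R a → Central R b → Central R (a * b)
  central-* {a} {b} ca cb z = begin
    a * b * z   ≈⟨ *-assoc a b z ⟩
    a * (b * z) ≈⟨ *-congˡ (cb z) ⟩
    a * (z * b) ≈⟨ *-assoc a z b ⟨
    a * z * b   ≈⟨ *-congʳ (ca z) ⟩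
    z * a * b   ≈⟨ *-assoc z a b ⟩
    z * (a * b) ∎

  central-neg : ∀ {a} → Central R a → Central R (- a)
  central-neg {a} ca z = begin
    - a * z   ≈⟨ -‿distribˡ-* a z ⟨
    - (a * z) ≈⟨ -‿cong (ca z) ⟩
    - (z * a) ≈⟨ -‿distribʳ-* z a ⟩
    z * - a   ∎

  central-inverse : ∀ {a w} → Central R a → a * w ≈ 1# → w * a ≈ 1# → Central R w
  central-inverse {a} {w} ca aw wa z = begin
    w * z             ≈⟨ *-congˡ (*-identityʳ z) ⟨
    w * (z * 1#)      ≈⟨ *-congˡ (*-congˡ aw) ⟨
    w * (z * (a * w)) ≈⟨ *-congˡ (*-assoc z a w) ⟨
    w * (z * a * w)   ≈⟨ *-congˡ (*-congʳ (ca z)) ⟨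
    w * (a * z * w)   ≈⟨ *-congˡ (*-assoc a z w) ⟩
    w * (a * (z * w)) ≈⟨ *-assoc w a (z * w) ⟨
    w * a * (z * w)   ≈⟨ *-congʳ wa ⟩
    1# * (z * w)      ≈⟨ *-identityˡ (z * w) ⟩
    z * w             ∎

  pull-central : ∀ {z} → Central R z → ∀ a b → a * (z * b) ≈ z * (a * b)
  pull-central {z} cz a b = begin
    a * (z * b) ≈⟨ *-assoc a z b ⟨
    a * z * b   ≈⟨ *-congʳ (cz a) ⟨
    z * a * b   ≈⟨ *-assoc z a b ⟩
    z * (a * b) ∎

  -- Polynomial identities between central scalars are proved by the semiring solver in the centre.
  centre : CommutativeSemiring (r₁ ⊔ r₂) r₂
  centre = record
    { Carrier = Σ Carrier (Central R)
    ; _≈_ = λ a b → proj₁ a ≈ proj₁ b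
    ; _+_ = λ (a , ca) (b , cb) → a + b , central-+ ca cb
    ; _*_ = λ (a , ca) (b , cb) → a * b , central-* ca cb
    ; 0# = 0# , central-0
    ; 1# = 1# , central-1
    ; isCommutativeSemiring = record
      { isSemiring = record
        { isSemiringWithoutAnnihilatingZero = record
          { +-isCommutativeMonoid = record
            { isMonoid = record
              { isSemigroup = record
                { isMagma = record
                  { isEquivalence = On.isEquivalence proj₁ isEquivalence
                  ; ∙-cong = +-cong }
                ; assoc = λ a b c → +-assoc (proj₁ a) (proj₁ b) (proj₁ c) }
              ; identity = (λ a → +-identityˡ (proj₁ a)) , (λ a → +-identityʳ (proj₁ a)) }
            ; comm = λ a b → +-comm (proj₁ a) (proj₁ b) }
          ; *-cong = *-cong
          ; *-assoc = λ a b c → *-assoc (proj₁ a) (proj₁ b) (proj₁ c)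
          ; *-identity = (λ a → *-identityˡ (proj₁ a)) , (λ a → *-identityʳ (proj₁ a))
          ; distrib = (λ a b c → distribˡ (proj₁ a) (proj₁ b) (proj₁ c))
                    , (λ a b c → distribʳ (proj₁ a) (proj₁ b) (proj₁ c)) }
        ; zero = (λ a → zeroˡ (proj₁ a)) , (λ a → zeroʳ (proj₁ a)) }
      ; *-comm = λ a b → proj₂ a (proj₁ b) } }

  diff-telescope : ∀ a m b → (a - m) + (m - b) ≈ a - b
  diff-telescope a m b = begin
    (a - m) + (m - b)        ≈⟨ +-solve 4 (λ a n m b → (a ⊞ n) ⊞ (m ⊞ b) ⊜⁺ a ⊞ ((n ⊞ m) ⊞ b)) refl a (- m) m (- b) ⟩
    a + ((- m + m) + - b)    ≈⟨ +-congˡ (+-congʳ (-‿inverseˡ m)) ⟩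
    a + (0# + - b)           ≈⟨ +-congˡ (+-identityˡ (- b)) ⟩
    a - b                    ∎

  diff-cancelʳ : ∀ a b m → (a + m) - (b + m) ≈ a - b
  diff-cancelʳ a b m = begin
    (a + m) - (b + m)          ≈⟨ +-congˡ (-‿+-comm b m) ⟨
    (a + m) + (- b + - m)      ≈⟨ +-solve 4 (λ a m n o → (a ⊞ m) ⊞ (n ⊞ o) ⊜⁺ (a ⊞ n) ⊞ (m ⊞ o)) refl a m (- b) (- m) ⟩
    (a - b) + (m - m)          ≈⟨ +-congˡ (-‿inverseʳ m) ⟩
    (a - b) + 0#               ≈⟨ +-identityʳ (a - b) ⟩
    a - b                      ∎

  sandwich-neg : ∀ a b d → a * - b * d ≈ - (a * b * d)
  sandwich-neg a b d = trans (*-congʳ (sym (-‿distribʳ-* a b))) (sym (-‿distribˡ-* (a * b) d))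

  Commute : Carrier → Carrier → Set r₂
  Commute a b = a * b ≈ b * a

  commute-resp : ∀ {a a′ b b′} → a ≈ a′ → b ≈ b′ → Commute a b → Commute a′ b′
  commute-resp aa′ bb′ ab = trans (*-cong (sym aa′) (sym bb′)) (trans ab (*-cong bb′ aa′))

  commute-* : ∀ {a b d} → Commute a b → Commute a d → Commute a (b * d)
  commute-* {a} {b} {d} ab ad = begin
    a * (b * d) ≈⟨ *-assoc a b d ⟨
    a * b * d   ≈⟨ *-congʳ ab ⟩
    b * a * d   ≈⟨ *-assoc b a d ⟩
    b * (a * d) ≈⟨ *-congˡ ad ⟩
    b * (d * a) ≈⟨ *-assoc b d a ⟨
    b * d * a   ∎

  commute-desc : ∀ {a} f s k → (∀ j → j < k → Commute a (f (s +ℕ j))) → Commute a (desc R f s k)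
  commute-desc f s zero    af = sym (central-1 _)
  commute-desc f s (suc k) af = commute-* (af k ≤-refl) (commute-desc f s k (λ j j<k → af j (m<n⇒m<1+n j<k)))

  commute-asc : ∀ {a} f s k → (∀ j → j < k → Commute a (f (s +ℕ j))) → Commute a (asc R f s k)
  commute-asc f s zero    af = sym (central-1 _)
  commute-asc f s (suc k) af = commute-* (commute-asc f s k (λ j j<k → af j (m<n⇒m<1+n j<k))) (af k ≤-refl)

  [_,_] : Carrier → Carrier → Carrier
  [ a , b ] = a * b - b * a

  commutator-swap : ∀ a b → a * b ≈ b * a + [ a , b ]
  commutator-swap a b = begin
    a * b                         ≈⟨ xyx⁻¹≈y (b * a) (a * b) ⟨
    b * a + a * b - b * a         ≈⟨ +-assoc (b * a) (a * b) (- (b * a)) ⟩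
    b * a + [ a , b ]             ∎

  commutator≈0⇒commute : ∀ {a b} → [ a , b ] ≈ 0# → Commute a b
  commutator≈0⇒commute {a} {b} eq = begin
    a * b             ≈⟨ commutator-swap a b ⟩
    b * a + [ a , b ] ≈⟨ +-congˡ eq ⟩
    b * a + 0#        ≈⟨ +-identityʳ (b * a) ⟩
    b * a             ∎

  commute⇒commutator≈0 : ∀ {a b} → Commute a b → [ a , b ] ≈ 0#
  commute⇒commutator≈0 {a} {b} ab = trans (+-congʳ ab) (-‿inverseʳ (b * a))

  commutator-cong : ∀ {a a′ b b′} → a ≈ a′ → b ≈ b′ → [ a , b ] ≈ [ a′ , b′ ]
  commutator-cong aa′ bb′ = +-cong (*-cong aa′ bb′) (-‿cong (*-cong bb′ aa′))

  commutator-anti : ∀ a b → [ a , b ] ≈ - [ b , a ]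
  commutator-anti a b = sym (⁻¹-anti-homo‿- (b * a) (a * b))

  commutator-+ˡ : ∀ a b d → [ a + b , d ] ≈ [ a , d ] + [ b , d ]
  commutator-+ˡ a b d = begin
    (a + b) * d - d * (a + b)               ≈⟨ +-cong (distribʳ d a b) (-‿cong (distribˡ d a b)) ⟩
    (a * d + b * d) - (d * a + d * b)       ≈⟨ +-congˡ (-‿+-comm (d * a) (d * b)) ⟨
    (a * d + b * d) + (- (d * a) + - (d * b)) ≈⟨ +-solve 4 (λ p q r s → (p ⊞ q) ⊞ (r ⊞ s) ⊜⁺ (p ⊞ r) ⊞ (q ⊞ s)) refl _ _ _ _ ⟩
    [ a , d ] + [ b , d ]                   ∎

  commutator-+ʳ : ∀ a b d → [ a , b + d ] ≈ [ a , b ] + [ a , d ]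
  commutator-+ʳ a b d = begin
    [ a , b + d ]                 ≈⟨ commutator-anti a (b + d) ⟩
    - [ b + d , a ]               ≈⟨ -‿cong (commutator-+ˡ b d a) ⟩
    - ([ b , a ] + [ d , a ])     ≈⟨ -‿+-comm [ b , a ] [ d , a ] ⟨
    - [ b , a ] + - [ d , a ]     ≈⟨ +-cong (commutator-anti a b) (commutator-anti a d) ⟨
    [ a , b ] + [ a , d ]         ∎

  commutator-*ˡ : ∀ {z} → Central R z → ∀ a b → [ z * a , b ] ≈ z * [ a , b ]
  commutator-*ˡ {z} cz a b = begin
    z * a * b - b * (z * a)     ≈⟨ +-cong (*-assoc z a b) (-‿cong (pull-central cz b a)) ⟩
    z * (a * b) - z * (b * a)   ≈⟨ x[y-z]≈xy-xz z (a * b) (b * a) ⟨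
    z * [ a , b ]               ∎

  commutator-*ʳ : ∀ {z} → Central R z → ∀ a b → [ a , z * b ] ≈ z * [ a , b ]
  commutator-*ʳ {z} cz a b = begin
    [ a , z * b ]       ≈⟨ commutator-anti a (z * b) ⟩
    - [ z * b , a ]     ≈⟨ -‿cong (commutator-*ˡ cz b a) ⟩
    - (z * [ b , a ])   ≈⟨ -‿distribʳ-* z [ b , a ] ⟩
    z * - [ b , a ]     ≈⟨ *-congˡ (commutator-anti a b) ⟨
    z * [ a , b ]       ∎

  commutator-1ˡ : ∀ a → [ 1# , a ] ≈ 0#
  commutator-1ˡ a = commute⇒commutator≈0 (central-1 a)

  commutator-conj : ∀ {a b} → Commute a b → ∀ e → [ a , b * e * b ] ≈ b * [ a , e ] * b
  commutator-conj {a} {b} ab e = begin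
    a * (b * e * b) - b * e * b * a    ≈⟨ +-cong left (-‿cong right) ⟩
    b * (a * e) * b - b * (e * a) * b  ≈⟨ [y-z]x≈yx-zx b (b * (a * e)) (b * (e * a)) ⟨
    (b * (a * e) - b * (e * a)) * b    ≈⟨ *-congʳ (x[y-z]≈xy-xz b (a * e) (e * a)) ⟨
    b * [ a , e ] * b                  ∎
    where
    left : a * (b * e * b) ≈ b * (a * e) * b
    left = begin
      a * (b * e * b)   ≈⟨ *-solve 3 (λ a b e → a · ((b · e) · b) ⊜ (a · b) · (e · b)) refl a b e ⟩
      a * b * (e * b)   ≈⟨ *-congʳ ab ⟩
      b * a * (e * b)   ≈⟨ *-solve 3 (λ a b e → (b · a) · (e · b) ⊜ (b · (a · e)) · b) refl a b e ⟩
      b * (a * e) * b   ∎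
    right : b * e * b * a ≈ b * (e * a) * b
    right = begin
      b * e * b * a     ≈⟨ *-assoc (b * e) b a ⟩
      b * e * (b * a)   ≈⟨ *-congˡ (sym ab) ⟩
      b * e * (a * b)   ≈⟨ *-solve 3 (λ a b e → (b · e) · (a · b) ⊜ (b · (e · a)) · b) refl a b e ⟩
      b * (e * a) * b   ∎

  commutator-expand : ∀ {p q} → Central R p → Central R q → ∀ A J B K →
                      [ A + p * J , B + q * K ] ≈ [ A , B ] + q * [ A , K ] + p * ([ J , B ] + q * [ J , K ])
  commutator-expand {p} {q} cp cq A J B K = begin
    [ A + p * J , B + q * K ]                              ≈⟨ commutator-+ˡ A (p * J) _ ⟩
    [ A , B + q * K ] + [ p * J , B + q * K ]              ≈⟨ +-cong (commutator-+ʳ A B (q * K)) (commutator-*ˡ cp J _) ⟩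
    [ A , B ] + [ A , q * K ] + p * [ J , B + q * K ]      ≈⟨ +-cong (+-congˡ (commutator-*ʳ cq A K)) (*-congˡ (commutator-+ʳ J B (q * K))) ⟩
    [ A , B ] + q * [ A , K ] + p * ([ J , B ] + [ J , q * K ]) ≈⟨ +-congˡ (*-congˡ (+-congˡ (commutator-*ʳ cq J K))) ⟩
    [ A , B ] + q * [ A , K ] + p * ([ J , B ] + q * [ J , K ]) ∎

  collect-scalars : ∀ {p q} → Central R p → Central R q → ∀ A B C D e →
    0# + q * (A * e) + p * (- (B * e) + q * (C * e - D * e)) ≈ (q * A + p * (q * C)) * e - (p * B + q * (p * D)) * e
  collect-scalars {p} {q} cp cq A B C D e = begin
    0# + q * (A * e) + p * (- (B * e) + q * (C * e - D * e))
      ≈⟨ +-cong (+-identityˡ _) (*-congˡ (+-congˡ (x[y-z]≈xy-xz q (C * e) (D * e)))) ⟩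
    q * (A * e) + p * (- (B * e) + (q * (C * e) - q * (D * e)))
      ≈⟨ +-congˡ (trans (distribˡ p _ _) (+-cong (sym (-‿distribʳ-* p _)) (x[y-z]≈xy-xz p _ _))) ⟩
    q * (A * e) + (- (p * (B * e)) + (p * (q * (C * e)) - p * (q * (D * e))))
      ≈⟨ +-cong (sym (*-assoc q A e)) (+-cong (-‿cong (sym (*-assoc p B e))) (+-cong (scale₂ C) (-‿cong (trans (scale₂ D) (*-congʳ (sym (pull-central cp q D))))))) ⟩
    q * A * e + (- (p * B * e) + (p * (q * C) * e - q * (p * D) * e))
      ≈⟨ +-solve 4 (λ a n c m → a ⊞ (n ⊞ (c ⊞ m)) ⊜⁺ (a ⊞ c) ⊞ (n ⊞ m)) refl _ _ _ _ ⟩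
    (q * A * e + p * (q * C) * e) + (- (p * B * e) - q * (p * D) * e)
      ≈⟨ +-cong (sym (distribʳ e (q * A) _)) (trans (-‿+-comm _ _) (-‿cong (sym (distribʳ e (p * B) _)))) ⟩
    (q * A + p * (q * C)) * e - (p * B + q * (p * D)) * e ∎
    where
    scale₂ : ∀ X → p * (q * (X * e)) ≈ p * (q * X) * e
    scale₂ X = trans (*-congˡ (sym (*-assoc q X e))) (sym (*-assoc p (q * X) e))

  h-distribˡ : ∀ x u a → h R x u * a ≈ a + x * (u * a)
  h-distribˡ x u a = begin
    (1# + x * u) * a   ≈⟨ distribʳ a 1# (x * u) ⟩
    1# * a + x * u * a ≈⟨ +-cong (*-identityˡ a) (*-assoc x u a) ⟩
    a + x * (u * a)    ∎

  h-distribʳ : ∀ {x} → Central R x → ∀ u a → a * h R x u ≈ a + x * (a * u)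
  h-distribʳ {x} cx u a = begin
    a * (1# + x * u)     ≈⟨ distribˡ a 1# (x * u) ⟩
    a * 1# + a * (x * u) ≈⟨ +-cong (*-identityʳ a) (pull-central cx a u) ⟩
    a + x * (a * u)      ∎

  commute-h : ∀ {x a g} → Central R x → Commute a g → Commute a (h R x g)
  commute-h {x} {a} {g} cx ag = begin
    a * h R x g     ≈⟨ h-distribʳ cx g a ⟩
    a + x * (a * g) ≈⟨ +-congˡ (*-congˡ ag) ⟩
    a + x * (g * a) ≈⟨ h-distribˡ x g a ⟨
    h R x g * a     ∎

  h-commute : ∀ {x y v w} → Central R x → Central R y → Commute v w → Commute (h R x v) (h R y w)
  h-commute cx cy vw = commute-h cy (sym (commute-h cx (sym vw)))

  commutator-hˡ : ∀ {z} → Central R z → ∀ u e → [ h R z u , e ] ≈ z * [ u , e ]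
  commutator-hˡ cz u e = begin
    [ 1# + _ * u , e ]           ≈⟨ commutator-+ˡ 1# _ e ⟩
    [ 1# , e ] + [ _ * u , e ]   ≈⟨ +-cong (commutator-1ˡ e) (commutator-*ˡ cz u e) ⟩
    0# + _ * [ u , e ]           ≈⟨ +-identityˡ _ ⟩
    _ * [ u , e ]                ∎

  commutator-h : ∀ {x y} → Central R x → Central R y → ∀ v w →
                 [ h R x v , h R y w ] ≈ x * y * [ v , w ]
  commutator-h {x} {y} cx cy v w = begin
    [ 1# + x * v , h R y w ]                ≈⟨ commutator-+ˡ 1# (x * v) (h R y w) ⟩
    [ 1# , h R y w ] + [ x * v , h R y w ]  ≈⟨ +-cong (commutator-1ˡ _) (commutator-*ˡ cx v (h R y w)) ⟩
    0# + x * [ v , 1# + y * w ]             ≈⟨ +-identityˡ _ ⟩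
    x * [ v , 1# + y * w ]                  ≈⟨ *-congˡ (commutator-+ʳ v 1# (y * w)) ⟩
    x * ([ v , 1# ] + [ v , y * w ])        ≈⟨ *-congˡ (+-cong v1 (commutator-*ʳ cy v w)) ⟩
    x * (0# + y * [ v , w ])                ≈⟨ *-congˡ (+-identityˡ _) ⟩
    x * (y * [ v , w ])                     ≈⟨ *-assoc x y [ v , w ] ⟨
    x * y * [ v , w ]                       ∎
    where
    v1 : [ v , 1# ] ≈ 0#
    v1 = commute⇒commutator≈0 (sym (central-1 v))

  h-swap : ∀ {x y} → Central R x → Central R y → ∀ v w →
           h R x v * h R y w ≈ h R y w * h R x v + x * y * [ v , w ]
  h-swap cx cy v w = trans (commutator-swap _ _) (+-congˡ (commutator-h cx cy v w))

  h-conj-split : ∀ {z} → Central R z → ∀ e u → e * h R z u * e ≈ e * e + z * (e * u * e)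
  h-conj-split {z} cz e u = begin
    e * h R z u * e          ≈⟨ *-congʳ (h-distribʳ cz u e) ⟩
    (e + z * (e * u)) * e    ≈⟨ distribʳ e e (z * (e * u)) ⟩
    e * e + z * (e * u) * e  ≈⟨ +-congˡ (*-assoc z (e * u) e) ⟩
    e * e + z * (e * u * e)  ∎

  cancel-middle : ∀ {y y′} → y * y′ ≈ 1# → ∀ x x′ → x * y * (y′ * x′) ≈ x * x′
  cancel-middle {y} {y′} yy′ x x′ = begin
    x * y * (y′ * x′)     ≈⟨ *-solve 4 (λ x y y′ x′ → (x · y) · (y′ · x′) ⊜ x · ((y · y′) · x′)) refl x y y′ x′ ⟩
    x * (y * y′ * x′)     ≈⟨ *-congˡ (*-congʳ yy′) ⟩
    x * (1# * x′)         ≈⟨ *-congˡ (*-identityˡ x′) ⟩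
    x * x′                ∎

  product-inverse : ∀ {a a′ b b′} → Commute b a′ → a * a′ ≈ 1# → b * b′ ≈ 1# → a * b * (a′ * b′) ≈ 1#
  product-inverse {a} {a′} {b} {b′} ba′ aa′ bb′ = begin
    a * b * (a′ * b′)     ≈⟨ *-solve 4 (λ a b a′ b′ → (a · b) · (a′ · b′) ⊜ a · ((b · a′) · b′)) refl a b a′ b′ ⟩
    a * (b * a′ * b′)     ≈⟨ *-congˡ (*-congʳ ba′) ⟩
    a * (a′ * b * b′)     ≈⟨ *-congˡ (*-assoc a′ b b′) ⟩
    a * (a′ * (b * b′))   ≈⟨ *-assoc a a′ (b * b′) ⟨
    a * a′ * (b * b′)     ≈⟨ *-cong aa′ bb′ ⟩
    1# * 1#               ≈⟨ *-identityˡ 1# ⟩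
    1#                    ∎

  asc-desc-inverse : ∀ f g s k → (∀ j → j < k → f (s +ℕ j) * g (s +ℕ j) ≈ 1#) → asc R f s k * desc R g s k ≈ 1#
  asc-desc-inverse f g s zero    fg = *-identityˡ 1#
  asc-desc-inverse f g s (suc k) fg = begin
    asc R f s k * f (s +ℕ k) * (g (s +ℕ k) * desc R g s k) ≈⟨ cancel-middle (fg k ≤-refl) _ _ ⟩
    asc R f s k * desc R g s k                             ≈⟨ asc-desc-inverse f g s k (λ j j<k → fg j (m<n⇒m<1+n j<k)) ⟩
    1#                                                     ∎

  desc-asc-inverse : ∀ f g s k → (∀ j → j < k → f (s +ℕ j) * g (s +ℕ j) ≈ 1#) → desc R f s k * asc R g s k ≈ 1#
  desc-asc-inverse f g s zero    fg = *-identityˡ 1#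
  desc-asc-inverse f g s (suc k) fg = begin
    f (s +ℕ k) * desc R f s k * (asc R g s k * g (s +ℕ k)) ≈⟨ cancel-middle (desc-asc-inverse f g s k (λ j j<k → fg j (m<n⇒m<1+n j<k))) _ _ ⟩
    f (s +ℕ k) * g (s +ℕ k)                                ≈⟨ fg k ≤-refl ⟩
    1#                                                     ∎

  palindrome : (ℕ → Carrier) → ℕ → ℕ → Carrier → Carrier
  palindrome f s k z = desc R f s k * z * asc R f s k

  palindrome-zero : ∀ f s z → palindrome f s 0 z ≈ z
  palindrome-zero f s z = trans (*-identityʳ (1# * z)) (*-identityˡ z)

  palindrome-suc : ∀ f s k z → palindrome f s (suc k) z ≈ f (s +ℕ k) * palindrome f s k z * f (s +ℕ k)
  palindrome-suc f s k z =
    *-solve 4 (λ a d z e → ((a · d) · z) · (e · a) ⊜ (a · ((d · z) · e)) · a) refl (f (s +ℕ k)) (desc R f s k) z (asc R f s k)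

  palindrome-one : ∀ f s z → palindrome f s 1 z ≈ f (s +ℕ 0) * z * f (s +ℕ 0)
  palindrome-one f s z = trans (palindrome-suc f s 0 z) (*-congʳ (*-congˡ (palindrome-zero f s z)))

  commute-palindrome : ∀ {a} f s k z → Commute a z → (∀ j → j < k → Commute a (f (s +ℕ j))) →
                       Commute a (palindrome f s k z)
  commute-palindrome f s k z az af = commute-* (commute-* (commute-desc f s k af) az) (commute-asc f s k af)

  palindrome-inverse : ∀ f g s k {z z′} → (∀ j → j < k → f (s +ℕ j) * g (s +ℕ j) ≈ 1#) → z * z′ ≈ 1# →
                       palindrome f s k z * palindrome g s k z′ ≈ 1#
  palindrome-inverse f g s k {z} {z′} fg zz′ = begin
    D * z * E * (D′ * z′ * E′)     ≈⟨ *-congˡ (*-assoc D′ z′ E′) ⟩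
    D * z * E * (D′ * (z′ * E′))   ≈⟨ cancel-middle (asc-desc-inverse f g s k fg) (D * z) (z′ * E′) ⟩
    D * z * (z′ * E′)              ≈⟨ cancel-middle zz′ D E′ ⟩
    D * E′                         ≈⟨ desc-asc-inverse f g s k fg ⟩
    1#                             ∎
    where
    D E D′ E′ : Carrier
    D = desc R f s k
    E = asc R f s k
    D′ = desc R g s k
    E′ = asc R g s k

  module IdCoxeter (β : Carrier) (cβ : Central R β) where

    infixl 6 _⊕_
    _⊕_ : Carrier → Carrier → Carrier
    x ⊕ y = x + y + x * y * β

    h-⊕ : ∀ {u x y} → u * u ≈ β * u → Central R y → h R x u * h R y u ≈ h R (x ⊕ y) u
    h-⊕ {u} {x} {y} uu cy = begin
      h R x u * h R y u                        ≈⟨ h-distribˡ x u (h R y u) ⟩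
      h R y u + x * (u * h R y u)              ≈⟨ +-congˡ (*-congˡ (h-distribʳ cy u u)) ⟩
      h R y u + x * (u + y * (u * u))          ≈⟨ +-congˡ (*-congˡ (+-congˡ (*-congˡ uu))) ⟩
      h R y u + x * (u + y * (β * u))          ≈⟨ +-congˡ (distribˡ x u (y * (β * u))) ⟩
      1# + y * u + (x * u + x * (y * (β * u))) ≈⟨ +-solve 4 (λ o p q r → (o ⊞ p) ⊞ (q ⊞ r) ⊜⁺ o ⊞ ((q ⊞ p) ⊞ r)) refl _ _ _ _ ⟩
      1# + (x * u + y * u + x * (y * (β * u))) ≈⟨ +-congˡ (+-cong (distribʳ u x y) reassoc) ⟨
      1# + ((x + y) * u + x * y * β * u)       ≈⟨ +-congˡ (distribʳ u (x + y) (x * y * β)) ⟨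
      h R (x ⊕ y) u                            ∎
      where
      reassoc : x * y * β * u ≈ x * (y * (β * u))
      reassoc = trans (*-assoc (x * y) β u) (*-assoc x y (β * u))

    h-inverse : ∀ {u x w} → u * u ≈ β * u → Central R x → Central R w → w * (1# + β * x) ≈ 1# →
                h R x u * h R (- (x * w)) u ≈ 1#
    h-inverse {u} {x} {w} uu cx cw inv = begin
      h R x u * h R (- (x * w)) u ≈⟨ h-⊕ uu (central-neg (central-* cx cw)) ⟩
      h R (x ⊕ - (x * w)) u       ≈⟨ +-congˡ (*-congʳ ⊕-inverse) ⟩
      1# + 0# * u                 ≈⟨ +-congˡ (zeroˡ u) ⟩
      1# + 0#                     ≈⟨ +-identityʳ 1# ⟩
      1#                          ∎
      where
      square-term : x * - (x * w) * β ≈ - (x * w * (β * x))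
      square-term = begin
        x * - (x * w) * β     ≈⟨ sandwich-neg x (x * w) β ⟩
        - (x * (x * w) * β)   ≈⟨ -‿cong (*-congʳ (cx (x * w))) ⟩
        - (x * w * x * β)     ≈⟨ -‿cong (*-assoc (x * w) x β) ⟩
        - (x * w * (x * β))   ≈⟨ -‿cong (*-congˡ (cβ x)) ⟨
        - (x * w * (β * x))   ∎
      cancels : x * w + x * w * (β * x) ≈ x
      cancels = begin
        x * w + x * w * (β * x)       ≈⟨ +-congʳ (*-identityʳ (x * w)) ⟨
        x * w * 1# + x * w * (β * x)  ≈⟨ distribˡ (x * w) 1# (β * x) ⟨
        x * w * (1# + β * x)          ≈⟨ *-assoc x w _ ⟩
        x * (w * (1# + β * x))        ≈⟨ *-congˡ inv ⟩
        x * 1#                        ≈⟨ *-identityʳ x ⟩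
        x                             ∎
      ⊕-inverse : x ⊕ - (x * w) ≈ 0#
      ⊕-inverse = begin
        x + - (x * w) + x * - (x * w) * β     ≈⟨ +-congˡ square-term ⟩
        x + - (x * w) + - (x * w * (β * x))   ≈⟨ +-assoc x _ _ ⟩
        x + (- (x * w) + - (x * w * (β * x))) ≈⟨ +-congˡ (-‿+-comm _ _) ⟩
        x - (x * w + x * w * (β * x))         ≈⟨ +-congˡ (-‿cong cancels) ⟩
        x - x                                 ≈⟨ -‿inverseʳ x ⟩
        0#                                    ∎

    idem-sandwich : ∀ {u} → u * u ≈ β * u → ∀ e → u * [ u , e ] * u ≈ 0#
    idem-sandwich {u} uu e = begin
      u * [ u , e ] * u                        ≈⟨ *-congʳ (x[y-z]≈xy-xz u (u * e) (e * u)) ⟩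
      (u * (u * e) - u * (e * u)) * u          ≈⟨ [y-z]x≈yx-zx u _ _ ⟩
      u * (u * e) * u - u * (e * u) * u        ≈⟨ +-cong left (-‿cong right) ⟩
      β * (u * e * u) - β * (u * e * u)        ≈⟨ -‿inverseʳ _ ⟩
      0#                                       ∎
      where
      left : u * (u * e) * u ≈ β * (u * e * u)
      left = begin
        u * (u * e) * u    ≈⟨ *-solve 2 (λ u e → (u · (u · e)) · u ⊜ (u · u) · (e · u)) refl u e ⟩
        u * u * (e * u)    ≈⟨ *-congʳ uu ⟩
        β * u * (e * u)    ≈⟨ *-assoc β u (e * u) ⟩
        β * (u * (e * u))  ≈⟨ *-congˡ (*-assoc u e u) ⟨
        β * (u * e * u)    ∎
      right : u * (e * u) * u ≈ β * (u * e * u)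
      right = begin
        u * (e * u) * u    ≈⟨ *-solve 2 (λ u e → (u · (e · u)) · u ⊜ (u · e) · (u · u)) refl u e ⟩
        u * e * (u * u)    ≈⟨ *-congˡ uu ⟩
        u * e * (β * u)    ≈⟨ pull-central cβ (u * e) u ⟩
        β * (u * e * u)    ∎

    idem-sandwich′ : ∀ {u} → u * u ≈ β * u → ∀ e → u * [ e , u ] * u ≈ 0#
    idem-sandwich′ {u} uu e = begin
      u * [ e , u ] * u     ≈⟨ *-congʳ (*-congˡ (commutator-anti e u)) ⟩
      u * - [ u , e ] * u   ≈⟨ sandwich-neg u [ u , e ] u ⟩
      - (u * [ u , e ] * u) ≈⟨ -‿cong (idem-sandwich uu e) ⟩
      - 0#                  ≈⟨ -0#≈0# ⟩
      0#                    ∎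

    record IsIdA₂ (v w : Carrier) : Set r₂ where
      field
        idem-v : v * v ≈ β * v
        idem-w : w * w ≈ β * w
        braid  : v * w * v ≈ w * v * w

    IsIdA₂-swap : ∀ {v w} → IsIdA₂ v w → IsIdA₂ w v
    IsIdA₂-swap rel = record { idem-v = idem-w ; idem-w = idem-v ; braid = sym braid }
      where open IsIdA₂ rel

    module _ {v w} (rel : IsIdA₂ v w) where
      open IsIdA₂ rel

      v-twist : v * [ w , v ] ≈ [ w , v ] * w
      v-twist = begin
        v * [ w , v ]              ≈⟨ x[y-z]≈xy-xz v (w * v) (v * w) ⟩
        v * (w * v) - v * (v * w)  ≈⟨ +-cong (trans (sym (*-assoc v w v)) braid) (-‿cong vvw) ⟩
        w * v * w - β * (v * w)    ≈⟨ +-congˡ (-‿cong vww) ⟨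
        w * v * w - v * w * w      ≈⟨ [y-z]x≈yx-zx w (w * v) (v * w) ⟨
        [ w , v ] * w              ∎
        where
        vvw : v * (v * w) ≈ β * (v * w)
        vvw = trans (sym (*-assoc v v w)) (trans (*-congʳ idem-v) (*-assoc β v w))
        vww : v * w * w ≈ β * (v * w)
        vww = trans (*-assoc v w w) (trans (*-congˡ idem-w) (pull-central cβ v w))

      twist : ∀ {x} → Central R x → h R x v * [ w , v ] ≈ [ w , v ] * h R x w
      twist {x} cx = begin
        h R x v * [ w , v ]          ≈⟨ h-distribˡ x v [ w , v ] ⟩
        [ w , v ] + x * (v * [ w , v ]) ≈⟨ +-congˡ (*-congˡ v-twist) ⟩
        [ w , v ] + x * ([ w , v ] * w) ≈⟨ h-distribʳ cx w [ w , v ] ⟨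
        [ w , v ] * h R x w          ∎

    module _ {v w} (rel : IsIdA₂ v w) where
      open IsIdA₂ rel

      negate-twist : ∀ {a b} → a * [ v , w ] ≈ [ v , w ] * b → a * [ w , v ] ≈ [ w , v ] * b
      negate-twist {a} {b} eq = begin
        a * [ w , v ]     ≈⟨ *-congˡ (commutator-anti w v) ⟩
        a * - [ v , w ]   ≈⟨ -‿distribʳ-* a [ v , w ] ⟨
        - (a * [ v , w ]) ≈⟨ -‿cong eq ⟩
        - ([ v , w ] * b) ≈⟨ -‿distribˡ-* [ v , w ] b ⟩
        - [ v , w ] * b   ≈⟨ *-congʳ (commutator-anti w v) ⟨
        [ w , v ] * b     ∎

      twist′ : ∀ {x} → Central R x → h R x w * [ w , v ] ≈ [ w , v ] * h R x v
      twist′ cx = negate-twist (twist (IsIdA₂-swap rel) cx)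

      commutator-square : [ w , v ] * [ w , v ] ≈ 0#
      commutator-square = begin
        δ * (w * v - v * w)            ≈⟨ x[y-z]≈xy-xz δ (w * v) (v * w) ⟩
        δ * (w * v) - δ * (v * w)      ≈⟨ +-cong (sym (*-assoc δ w v)) (-‿cong (sym (*-assoc δ v w))) ⟩
        δ * w * v - δ * v * w          ≈⟨ +-cong (*-congʳ (sym (v-twist rel))) (-‿cong (*-congʳ w-twist)) ⟩
        v * δ * v - w * δ * w          ≈⟨ +-cong (idem-sandwich′ idem-v w) (-‿cong (idem-sandwich idem-w v)) ⟩
        0# - 0#                        ≈⟨ -‿inverseʳ 0# ⟩
        0#                             ∎
        where
        δ : Carrier
        δ = [ w , v ]
        w-twist : δ * v ≈ w * δ
        w-twist = sym (negate-twist (v-twist (IsIdA₂-swap rel)))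

      module _ {x y} (cx : Central R x) (cy : Central R y) where
        private
          a b c d : Carrier
          a = h R x v
          b = h R y v
          c = h R x w
          d = h R y w
          cxy : Central R (x * y)
          cxy = central-* cx cy

        Λ : Carrier
        Λ = a * b + x * y * [ w , v ]

        Λ′ : Carrier
        Λ′ = a * b + x * y * [ v , w ]

        outer-left : a * c * b ≈ Λ * c
        outer-left = begin
          a * c * b                              ≈⟨ *-assoc a c b ⟩
          a * (c * b)                            ≈⟨ *-congˡ (h-swap cx cy w v) ⟩
          a * (b * c + x * y * [ w , v ])        ≈⟨ distribˡ a (b * c) _ ⟩
          a * (b * c) + a * (x * y * [ w , v ])  ≈⟨ +-cong (sym (*-assoc a b c)) (pull-central cxy a _) ⟩
          a * b * c + x * y * (a * [ w , v ])    ≈⟨ +-congˡ (*-congˡ (twist rel cx)) ⟩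
          a * b * c + x * y * ([ w , v ] * c)    ≈⟨ +-congˡ (*-assoc (x * y) [ w , v ] c) ⟨
          a * b * c + x * y * [ w , v ] * c      ≈⟨ distribʳ c (a * b) _ ⟨
          Λ * c                                  ∎

        outer-right : a * d * b ≈ d * Λ′
        outer-right = begin
          a * d * b                              ≈⟨ *-congʳ (h-swap cx cy v w) ⟩
          (d * a + x * y * [ v , w ]) * b        ≈⟨ distribʳ b (d * a) _ ⟩
          d * a * b + x * y * [ v , w ] * b      ≈⟨ +-cong (*-assoc d a b) (*-assoc (x * y) _ b) ⟩
          d * (a * b) + x * y * ([ v , w ] * b)  ≈⟨ +-congˡ (*-congˡ (sym (twist (IsIdA₂-swap rel) cy))) ⟩
          d * (a * b) + x * y * (d * [ v , w ])  ≈⟨ +-congˡ (pull-central cxy d _) ⟨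
          d * (a * b) + d * (x * y * [ v , w ])  ≈⟨ distribˡ d (a * b) _ ⟨
          d * Λ′                                 ∎

    module _ {v w} (rel : IsIdA₂ v w) {x y} (cx : Central R x) (cy : Central R y) where
      private
        a b c d δ xy : Carrier
        a = h R x v
        b = h R y v
        c = h R x w
        d = h R y w
        δ = [ w , v ]
        xy = x * y
        cxy : Central R xy
        cxy = central-* cx cy

      yang-baxter : c * (a * b) * d ≈ b * (c * d) * a
      yang-baxter = begin
        c * (a * b) * d                             ≈⟨ *-congʳ (*-congˡ (h-commute cx cy refl)) ⟩
        c * (b * a) * d                             ≈⟨ *-solve 4 (λ c b a d → (c · (b · a)) · d ⊜ (c · b) · (a · d)) refl c b a d ⟩
        c * b * (a * d)                             ≈⟨ *-congˡ (h-swap cx cy v w) ⟩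
        c * b * (d * a + xy * [ v , w ])             ≈⟨ distribˡ (c * b) (d * a) _ ⟩
        c * b * (d * a) + c * b * (xy * [ v , w ])   ≈⟨ +-congʳ (*-assoc (c * b) d a) ⟨
        c * b * d * a + c * b * (xy * [ v , w ])     ≈⟨ +-congʳ (*-congʳ (outer-right (IsIdA₂-swap rel) cx cy)) ⟩
        b * (c * d + xy * δ) * a + c * b * (xy * [ v , w ])
          ≈⟨ +-congʳ (trans (*-congʳ (distribˡ b (c * d) (xy * δ))) (distribʳ a (b * (c * d)) (b * (xy * δ)))) ⟩
        b * (c * d) * a + b * (xy * δ) * a + c * b * (xy * [ v , w ])
          ≈⟨ +-assoc _ _ _ ⟩
        b * (c * d) * a + (b * (xy * δ) * a + c * b * (xy * [ v , w ]))
          ≈⟨ +-congˡ error-terms ⟩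
        b * (c * d) * a + 0#                        ≈⟨ +-identityʳ _ ⟩
        b * (c * d) * a                             ∎
        where
        cbδ : c * b * δ ≈ δ * a * d
        cbδ = begin
          c * b * δ     ≈⟨ *-assoc c b δ ⟩
          c * (b * δ)   ≈⟨ *-congˡ (twist rel cy) ⟩
          c * (δ * d)   ≈⟨ *-assoc c δ d ⟨
          c * δ * d     ≈⟨ *-congʳ (twist′ rel cx) ⟩
          δ * a * d     ∎
        cancel : b * δ * a + c * b * [ v , w ] ≈ 0#
        cancel = begin
          b * δ * a + c * b * [ v , w ]   ≈⟨ +-cong (*-congʳ (twist rel cy)) (*-congˡ (commutator-anti v w)) ⟩
          δ * d * a + c * b * - δ         ≈⟨ +-congˡ (-‿distribʳ-* (c * b) δ) ⟨
          δ * d * a - c * b * δ           ≈⟨ +-congˡ (-‿cong cbδ) ⟩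
          δ * d * a - δ * a * d           ≈⟨ +-cong (*-assoc δ d a) (-‿cong (*-assoc δ a d)) ⟩
          δ * (d * a) - δ * (a * d)       ≈⟨ x[y-z]≈xy-xz δ (d * a) (a * d) ⟨
          δ * [ d , a ]                   ≈⟨ *-congˡ (commutator-h cy cx w v) ⟩
          δ * (y * x * δ)                 ≈⟨ pull-central (central-* cy cx) δ δ ⟩
          y * x * (δ * δ)                 ≈⟨ *-congˡ (commutator-square rel) ⟩
          y * x * 0#                      ≈⟨ zeroʳ (y * x) ⟩
          0#                              ∎
        error-terms : b * (xy * δ) * a + c * b * (xy * [ v , w ]) ≈ 0#
        error-terms = begin
          b * (xy * δ) * a + c * b * (xy * [ v , w ])
            ≈⟨ +-cong (trans (*-congʳ (pull-central cxy b δ)) (*-assoc xy (b * δ) a)) (pull-central cxy (c * b) _) ⟩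
          xy * (b * δ * a) + xy * (c * b * [ v , w ])  ≈⟨ distribˡ xy _ _ ⟨
          xy * (b * δ * a + c * b * [ v , w ])        ≈⟨ *-congˡ cancel ⟩
          xy * 0#                                     ≈⟨ zeroʳ xy ⟩
          0#                                         ∎

    module _ {v w} (rel : IsIdA₂ v w) {x y} (cx : Central R x) (cy : Central R y) where
      private
        a b c d : Carrier
        a = h R x v
        b = h R y v
        c = h R x w
        d = h R y w

      Λ-symmetric : Λ rel cx cy ≈ Λ rel cy cx
      Λ-symmetric = +-cong (h-commute cx cy refl) (*-congʳ (cx y))

      Λ′-symmetric : Λ′ rel cx cy ≈ Λ′ rel cy cx
      Λ′-symmetric = +-cong (h-commute cx cy refl) (*-congʳ (cx y))

      desc-sandwich : ∀ {g k} → Commute g b → (a * (c * g)) * (b * (d * k)) ≈ Λ rel cx cy * ((c * g) * (d * k))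
      desc-sandwich {g} {k} gb = begin
        a * (c * g) * (b * (d * k))   ≈⟨ *-solve 6 (λ a c g b d k → (a · (c · g)) · (b · (d · k))
                                                                  ⊜ ((a · c) · (g · b)) · (d · k)) refl a c g b d k ⟩
        a * c * (g * b) * (d * k)     ≈⟨ *-congʳ (*-congˡ gb) ⟩
        a * c * (b * g) * (d * k)     ≈⟨ *-solve 6 (λ a c g b d k → ((a · c) · (b · g)) · (d · k)
                                                                  ⊜ ((a · c) · b) · (g · (d · k))) refl a c g b d k ⟩
        a * c * b * (g * (d * k))     ≈⟨ *-congʳ (outer-left rel cx cy) ⟩
        Λ rel cx cy * c * (g * (d * k)) ≈⟨ *-solve 5 (λ L c g d k → (L · c) · (g · (d · k)) ⊜ L · ((c · g) · (d · k))) refl _ c g d k ⟩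
        Λ rel cx cy * ((c * g) * (d * k)) ∎

      palindrome-sandwich : ∀ {g k} → Commute g b → Commute a k →
                            (a * (c * g * c) * a) * (b * (d * k * d) * b) ≈ Λ rel cx cy * ((c * g * c) * (d * k * d)) * Λ′ rel cx cy
      palindrome-sandwich {g} {k} gb ak = begin
        (a * (c * g * c) * a) * (b * (d * k * d) * b)
          ≈⟨ *-solve 6 (λ a c g b d k → ((a · ((c · g) · c)) · a) · ((b · ((d · k) · d)) · b)
                                      ⊜ (((a · c) · g) · ((c · (a · b)) · d)) · ((k · d) · b)) refl a c g b d k ⟩
        (a * c * g) * (c * (a * b) * d) * (k * d * b)   ≈⟨ *-congʳ (*-congˡ (yang-baxter rel cx cy)) ⟩
        (a * c * g) * (b * (c * d) * a) * (k * d * b)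
          ≈⟨ *-solve 6 (λ a c g b d k → (((a · c) · g) · ((b · (c · d)) · a)) · ((k · d) · b)
                                      ⊜ ((((a · c) · (g · b)) · (c · d)) · (a · k)) · (d · b)) refl a c g b d k ⟩
        a * c * (g * b) * (c * d) * (a * k) * (d * b)   ≈⟨ *-congʳ (*-cong (*-congʳ (*-congˡ gb)) ak) ⟩
        a * c * (b * g) * (c * d) * (k * a) * (d * b)
          ≈⟨ *-solve 6 (λ a c g b d k → ((((a · c) · (b · g)) · (c · d)) · (k · a)) · (d · b)
                                      ⊜ (((a · c) · b) · ((g · (c · d)) · k)) · ((a · d) · b)) refl a c g b d k ⟩
        (a * c * b) * (g * (c * d) * k) * (a * d * b)  ≈⟨ *-cong (*-congʳ (outer-left rel cx cy)) (outer-right rel cx cy) ⟩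
        (Λ rel cx cy * c) * (g * (c * d) * k) * (d * Λ′ rel cx cy)
          ≈⟨ *-solve 6 (λ L c g d k L′ → ((L · c) · ((g · (c · d)) · k)) · (d · L′)
                                       ⊜ (L · (((c · g) · c) · ((d · k) · d))) · L′) refl _ c g d k _ ⟩
        Λ rel cx cy * ((c * g * c) * (d * k * d)) * Λ′ rel cx cy ∎

    module _ {v w} (rel : IsIdA₂ v w) {x y} (cx : Central R x) (cy : Central R y) where
      private
        a b c d : Carrier
        a = h R x v
        b = h R y v
        c = h R x w
        d = h R y w

      descs-commute-step : ∀ {g k} → Commute g v → Commute k v → Commute (c * g) (d * k) →
                           Commute (a * (c * g)) (b * (d * k))
      descs-commute-step {g} {k} gv kv IH = begin
        a * (c * g) * (b * (d * k))         ≈⟨ desc-sandwich rel cx cy (commute-h cy gv) ⟩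
        Λ rel cx cy * ((c * g) * (d * k))   ≈⟨ *-cong (Λ-symmetric rel cx cy) IH ⟩
        Λ rel cy cx * ((d * k) * (c * g))   ≈⟨ desc-sandwich rel cy cx (commute-h cx kv) ⟨
        b * (d * k) * (a * (c * g))         ∎

      palindromes-commute-step : ∀ {g k} → Commute g v → Commute k v → Commute (c * g * c) (d * k * d) →
                                 Commute (a * (c * g * c) * a) (b * (d * k * d) * b)
      palindromes-commute-step {g} {k} gv kv IH = begin
        (a * (c * g * c) * a) * (b * (d * k * d) * b)
          ≈⟨ palindrome-sandwich rel cx cy (commute-h cy gv) (sym (commute-h cx kv)) ⟩
        Λ rel cx cy * ((c * g * c) * (d * k * d)) * Λ′ rel cx cy
          ≈⟨ *-cong (*-cong (Λ-symmetric rel cx cy) IH) (Λ′-symmetric rel cx cy) ⟩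
        Λ rel cy cx * ((d * k * d) * (c * g * c)) * Λ′ rel cy cx
          ≈⟨ palindrome-sandwich rel cy cx (commute-h cx kv) (sym (commute-h cy gv)) ⟨
        (b * (d * k * d) * b) * (a * (c * g * c) * a) ∎

    module _ {v w w′} (rel : IsIdA₂ v w) (rel′ : IsIdA₂ v w′) (ww′ : Commute w w′)
             {x y} (cx : Central R x) (cy : Central R y) where
      private
        a b c d e f : Carrier
        a = h R x v
        b = h R y v
        c = h R x w
        d = h R y w
        e = h R x w′
        f = h R y w′

      fork-sandwich : (a * (c * e) * a) * (b * (d * f) * b) ≈ Λ rel′ cx cy * (e * (c * d) * f) * Λ′ rel′ cx cy
      fork-sandwich = begin
        (a * (c * e) * a) * (b * (d * f) * b)   ≈⟨ *-congʳ (*-congʳ (*-congˡ (h-commute cx cx ww′))) ⟩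
        (a * (e * c) * a) * (b * (d * f) * b)
          ≈⟨ *-solve 6 (λ a e c b d f → ((a · (e · c)) · a) · ((b · (d · f)) · b)
                                      ⊜ ((a · e) · ((c · (a · b)) · d)) · (f · b)) refl a e c b d f ⟩
        (a * e) * (c * (a * b) * d) * (f * b)   ≈⟨ *-congʳ (*-congˡ (yang-baxter rel cx cy)) ⟩
        (a * e) * (b * (c * d) * a) * (f * b)
          ≈⟨ *-solve 6 (λ a e c b d f → ((a · e) · ((b · (c · d)) · a)) · (f · b)
                                      ⊜ (((a · e) · b) · (c · d)) · ((a · f) · b)) refl a e c b d f ⟩
        (a * e * b) * (c * d) * (a * f * b)     ≈⟨ *-cong (*-congʳ (outer-left rel′ cx cy)) (outer-right rel′ cx cy) ⟩
        (Λ rel′ cx cy * e) * (c * d) * (f * Λ′ rel′ cx cy)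
          ≈⟨ *-solve 6 (λ L e c d f L′ → ((L · e) · (c · d)) · (f · L′) ⊜ (L · ((e · (c · d)) · f)) · L′) refl _ e c d f _ ⟩
        Λ rel′ cx cy * (e * (c * d) * f) * Λ′ rel′ cx cy ∎

      fork-middle-symmetric : e * (c * d) * f ≈ f * (d * c) * e
      fork-middle-symmetric = begin
        e * (c * d) * f     ≈⟨ *-congʳ (commute-* (h-commute cx cx w′w) (h-commute cx cy w′w)) ⟩
        c * d * e * f       ≈⟨ *-assoc (c * d) e f ⟩
        c * d * (e * f)     ≈⟨ *-cong (h-commute cx cy refl) (h-commute cx cy refl) ⟩
        d * c * (f * e)     ≈⟨ *-assoc (d * c) f e ⟨
        d * c * f * e       ≈⟨ *-congʳ (commute-* (h-commute cy cy w′w) (h-commute cy cx w′w)) ⟨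
        f * (d * c) * e     ∎
        where
        w′w : Commute w′ w
        w′w = sym ww′

    module _ {v w w′} (rel : IsIdA₂ v w) (rel′ : IsIdA₂ v w′) (ww′ : Commute w w′)
             {x y} (cx : Central R x) (cy : Central R y) where

      forks-commute : Commute (h R x v * (h R x w * h R x w′) * h R x v) (h R y v * (h R y w * h R y w′) * h R y v)
      forks-commute = begin
        (h R x v * (h R x w * h R x w′) * h R x v) * (h R y v * (h R y w * h R y w′) * h R y v)
          ≈⟨ fork-sandwich rel rel′ ww′ cx cy ⟩
        Λ rel′ cx cy * (h R x w′ * (h R x w * h R y w) * h R y w′) * Λ′ rel′ cx cy
          ≈⟨ *-cong (*-cong (Λ-symmetric rel′ cx cy) (fork-middle-symmetric rel rel′ ww′ cx cy)) (Λ′-symmetric rel′ cx cy) ⟩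
        Λ rel′ cy cx * (h R y w′ * (h R y w * h R x w) * h R x w′) * Λ′ rel′ cy cx
          ≈⟨ fork-sandwich rel rel′ ww′ cy cx ⟨
        (h R y v * (h R y w * h R y w′) * h R y v) * (h R x v * (h R x w * h R x w′) * h R x v) ∎

    record IsIdB₂ (t r : Carrier) : Set r₂ where
      field
        idem-t : t * t ≈ β * t
        idem-r : r * r ≈ β * r
        braid  : r * t * r * t ≈ t * r * t * r

    h-conj-commutator : ∀ {u y} → u * u ≈ β * u → Central R y → ∀ e →
                        h R y u * [ u , e ] * h R y u ≈ (1# + β * y) * [ u , e ]
    h-conj-commutator {u} {y} uu cy e = begin
      h R y u * C * h R y u                                  ≈⟨ *-congʳ (h-distribˡ y u C) ⟩
      (C + y * (u * C)) * h R y u                            ≈⟨ h-distribʳ cy u _ ⟩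
      C + y * (u * C) + y * ((C + y * (u * C)) * u)          ≈⟨ +-congˡ (*-congˡ right-factor) ⟩
      C + y * (u * C) + y * (C * u)                          ≈⟨ +-assoc C _ _ ⟩
      C + (y * (u * C) + y * (C * u))                        ≈⟨ +-congˡ (distribˡ y (u * C) (C * u)) ⟨
      C + y * (u * C + C * u)                                ≈⟨ +-congˡ (*-congˡ anticommutator) ⟩
      C + y * (β * C)                                        ≈⟨ +-congˡ (trans (sym (*-assoc y β C)) (*-congʳ (sym (cβ y)))) ⟩
      C + β * y * C                                          ≈⟨ +-congʳ (*-identityˡ C) ⟨
      1# * C + β * y * C                                     ≈⟨ distribʳ C 1# (β * y) ⟨
      (1# + β * y) * C                                       ∎
      where
      C : Carrier
      C = [ u , e ]
      right-factor : (C + y * (u * C)) * u ≈ C * u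
      right-factor = begin
        (C + y * (u * C)) * u     ≈⟨ distribʳ u C (y * (u * C)) ⟩
        C * u + y * (u * C) * u   ≈⟨ +-congˡ (*-assoc y (u * C) u) ⟩
        C * u + y * (u * C * u)   ≈⟨ +-congˡ (*-congˡ (idem-sandwich uu e)) ⟩
        C * u + y * 0#            ≈⟨ +-congˡ (zeroʳ y) ⟩
        C * u + 0#                ≈⟨ +-identityʳ (C * u) ⟩
        C * u                     ∎
      anticommutator : u * C + C * u ≈ β * C
      anticommutator = begin
        u * C + C * u                                          ≈⟨ +-cong (x[y-z]≈xy-xz u (u * e) (e * u)) ([y-z]x≈yx-zx u (u * e) (e * u)) ⟩
        (u * (u * e) - u * (e * u)) + (u * e * u - e * u * u)  ≈⟨ +-cong (+-cong uue (-‿cong (sym (*-assoc u e u)))) (+-congˡ (-‿cong euu)) ⟩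
        (β * (u * e) - u * e * u) + (u * e * u - β * (e * u))  ≈⟨ diff-telescope _ _ _ ⟩
        β * (u * e) - β * (e * u)                              ≈⟨ x[y-z]≈xy-xz β (u * e) (e * u) ⟨
        β * C                                                  ∎
        where
        uue : u * (u * e) ≈ β * (u * e)
        uue = trans (sym (*-assoc u u e)) (trans (*-congʳ uu) (*-assoc β u e))
        euu : e * u * u ≈ β * (e * u)
        euu = trans (*-assoc e u u) (trans (*-congˡ uu) (pull-central cβ e u))

    central-⊕ : ∀ {x y} → Central R x → Central R y → Central R (x ⊕ y)
    central-⊕ cx cy = central-+ (central-+ cx cy) (central-* (central-* cx cy) cβ)

    κ : Carrier → Carrier → Carrier → Carrier → Carrier
    κ x y p q = q * ((x ⊕ x) * (1# + β * y)) + p * (q * (β * x))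

    module _ {t r} (rel : IsIdB₂ t r) where
      open IsIdB₂ rel
      private
        ε ρ : Carrier
        ε = [ t , r ]
        ρ = r * t * r

      ρ-commute-h : ∀ {x} → Central R x → Commute ρ (h R x t)
      ρ-commute-h cx = commute-h cx (trans braid (*-solve 2 (λ t r → ((t · r) · t) · r ⊜ t · ((r · t) · r)) refl t r))

      r-h-r-expansion : ∀ {s a′ b′} → Central R s → Commute ρ a′ →
                        a′ * (r * h R s t * r) * b′ ≈ β * (a′ * r * b′) + s * (ρ * (a′ * b′))
      r-h-r-expansion {s} {a′} {b′} cs ρa′ = begin
        a′ * (r * h R s t * r) * b′               ≈⟨ *-congʳ (*-congˡ (trans (h-conj-split cs r t) (+-congʳ idem-r))) ⟩
        a′ * (β * r + s * ρ) * b′                 ≈⟨ *-congʳ (distribˡ a′ (β * r) (s * ρ)) ⟩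
        (a′ * (β * r) + a′ * (s * ρ)) * b′        ≈⟨ distribʳ b′ _ _ ⟩
        a′ * (β * r) * b′ + a′ * (s * ρ) * b′     ≈⟨ +-cong (*-congʳ (pull-central cβ a′ r)) (*-congʳ (pull-central cs a′ ρ)) ⟩
        β * (a′ * r) * b′ + s * (a′ * ρ) * b′     ≈⟨ +-cong (*-assoc β (a′ * r) b′) (*-assoc s (a′ * ρ) b′) ⟩
        β * (a′ * r * b′) + s * (a′ * ρ * b′)     ≈⟨ +-congˡ (*-congˡ (trans (*-congʳ (sym ρa′)) (*-assoc ρ a′ b′))) ⟩
        β * (a′ * r * b′) + s * (ρ * (a′ * b′))   ∎

      module _ {x y} (cx : Central R x) (cy : Central R y) where
        private
          a b : Carrier
          a = h R x t
          b = h R y t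

        conj-r-product : (a * r * a) * (b * r * b) ≈ β * (a * r * b) + (x ⊕ y) * (ρ * (a * b))
        conj-r-product = begin
          (a * r * a) * (b * r * b)   ≈⟨ *-solve 3 (λ a r b → ((a · r) · a) · ((b · r) · b) ⊜ (a · ((r · (a · b)) · r)) · b) refl a r b ⟩
          a * (r * (a * b) * r) * b   ≈⟨ *-congʳ (*-congˡ (*-congʳ (*-congˡ (h-⊕ idem-t cy)))) ⟩
          a * (r * h R (x ⊕ y) t * r) * b ≈⟨ r-h-r-expansion (central-⊕ cx cy) (ρ-commute-h cx) ⟩
          β * (a * r * b) + (x ⊕ y) * (ρ * (a * b)) ∎

        conj-r-expansion : a * r * b ≈ r * (a * b) + (x * ε + x * y * (ε * t))
        conj-r-expansion = begin
          a * r * b                              ≈⟨ *-congʳ (trans (commutator-swap a r) (+-congˡ (commutator-hˡ cx t r))) ⟩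
          (r * a + x * ε) * b                    ≈⟨ distribʳ b (r * a) (x * ε) ⟩
          r * a * b + x * ε * b                  ≈⟨ +-cong (*-assoc r a b) (*-assoc x ε b) ⟩
          r * (a * b) + x * (ε * b)              ≈⟨ +-congˡ (*-congˡ (h-distribʳ cy t ε)) ⟩
          r * (a * b) + x * (ε + y * (ε * t))    ≈⟨ +-congˡ (distribˡ x ε (y * (ε * t))) ⟩
          r * (a * b) + (x * ε + x * (y * (ε * t))) ≈⟨ +-congˡ (+-congˡ (*-assoc x y (ε * t))) ⟨
          r * (a * b) + (x * ε + x * y * (ε * t)) ∎

        square-conj-r-commutator : [ a * a , b * r * b ] ≈ (x ⊕ x) * (1# + β * y) * ε
        square-conj-r-commutator = begin
          [ a * a , b * r * b ]        ≈⟨ commutator-conj aa-b r ⟩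
          b * [ a * a , r ] * b        ≈⟨ *-congʳ (*-congˡ (trans (commutator-cong (h-⊕ idem-t cx) refl) (commutator-hˡ cX t r))) ⟩
          b * ((x ⊕ x) * ε) * b        ≈⟨ trans (*-congʳ (pull-central cX b ε)) (*-assoc (x ⊕ x) (b * ε) b) ⟩
          (x ⊕ x) * (b * ε * b)        ≈⟨ *-congˡ (h-conj-commutator idem-t cy r) ⟩
          (x ⊕ x) * ((1# + β * y) * ε) ≈⟨ *-assoc (x ⊕ x) _ ε ⟨
          (x ⊕ x) * (1# + β * y) * ε   ∎
          where
          cX : Central R (x ⊕ x)
          cX = central-⊕ cx cx
          ba : Commute b a
          ba = h-commute cy cx refl
          aa-b : Commute (a * a) b
          aa-b = sym (commute-* ba ba)

      module _ {x y} (cx : Central R x) (cy : Central R y) where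
        private
          a b : Carrier
          a = h R x t
          b = h R y t
          ab : Commute a b
          ab = h-commute cx cy refl

        conj-r-difference : a * r * b - b * r * a ≈ x * ε - y * ε
        conj-r-difference = begin
          a * r * b - b * r * a
            ≈⟨ +-cong (conj-r-expansion cx cy) (-‿cong (conj-r-expansion cy cx)) ⟩
          (r * (a * b) + (x * ε + Q)) - (r * (b * a) + (y * ε + y * x * (ε * t)))
            ≈⟨ +-congˡ (-‿cong (+-cong (*-congˡ (sym ab)) (+-congˡ (*-congʳ (cy x))))) ⟩
          (r * (a * b) + (x * ε + Q)) - (r * (a * b) + (y * ε + Q))
            ≈⟨ +-cong (regroup _ _ _) (-‿cong (regroup _ _ _)) ⟩
          (x * ε + (r * (a * b) + Q)) - (y * ε + (r * (a * b) + Q))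
            ≈⟨ diff-cancelʳ _ _ _ ⟩
          x * ε - y * ε ∎
          where
          Q : Carrier
          Q = x * y * (ε * t)
          regroup : ∀ m n o → m + (n + o) ≈ n + (m + o)
          regroup = +-solve 3 (λ m n o → m ⊞ (n ⊞ o) ⊜⁺ n ⊞ (m ⊞ o)) refl

        conj-r-commutator : [ a * r * a , b * r * b ] ≈ β * x * ε - β * y * ε
        conj-r-commutator = begin
          [ a * r * a , b * r * b ]
            ≈⟨ +-cong (conj-r-product cx cy) (-‿cong (conj-r-product cy cx)) ⟩
          (β * (a * r * b) + (x ⊕ y) * (ρ * (a * b))) - (β * (b * r * a) + (y ⊕ x) * (ρ * (b * a)))
            ≈⟨ +-congˡ (-‿cong (+-congˡ (*-cong ⊕-comm (*-congˡ (sym ab))))) ⟩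
          (β * (a * r * b) + (x ⊕ y) * (ρ * (a * b))) - (β * (b * r * a) + (x ⊕ y) * (ρ * (a * b)))
            ≈⟨ diff-cancelʳ _ _ _ ⟩
          β * (a * r * b) - β * (b * r * a)     ≈⟨ x[y-z]≈xy-xz β _ _ ⟨
          β * (a * r * b - b * r * a)           ≈⟨ *-congˡ conj-r-difference ⟩
          β * (x * ε - y * ε)                   ≈⟨ x[y-z]≈xy-xz β _ _ ⟩
          β * (x * ε) - β * (y * ε)             ≈⟨ +-cong (sym (*-assoc β x ε)) (-‿cong (sym (*-assoc β y ε))) ⟩
          β * x * ε - β * y * ε                 ∎
          where
          ⊕-comm : y ⊕ x ≈ x ⊕ y
          ⊕-comm = +-cong (+-comm y x) (*-congʳ (cy x))

      module _ {x y p q} (cx : Central R x) (cy : Central R y) (cp : Central R p) (cq : Central R q) where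
        private
          a b : Carrier
          a = h R x t
          b = h R y t

        commutator-B₂-palindromes : [ a * h R p r * a , b * h R q r * b ] ≈ κ x y p q * ε - κ y x q p * ε
        commutator-B₂-palindromes = begin
          [ a * h R p r * a , b * h R q r * b ]
            ≈⟨ commutator-cong (h-conj-split cp a r) (h-conj-split cq b r) ⟩
          [ a * a + p * (a * r * a) , b * b + q * (b * r * b) ]
            ≈⟨ commutator-expand cp cq _ _ _ _ ⟩
          [ a * a , b * b ] + q * [ a * a , b * r * b ] + p * ([ a * r * a , b * b ] + q * [ a * r * a , b * r * b ])
            ≈⟨ +-cong (+-cong (commute⇒commutator≈0 aa-bb) (*-congˡ (square-conj-r-commutator cx cy)))
                      (*-congˡ (+-cong (trans (commutator-anti _ _) (-‿cong (square-conj-r-commutator cy cx))) (*-congˡ (conj-r-commutator cx cy)))) ⟩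
          0# + q * ((x ⊕ x) * (1# + β * y) * ε) + p * (- ((y ⊕ y) * (1# + β * x) * ε) + q * (β * x * ε - β * y * ε))
            ≈⟨ collect-scalars cp cq _ _ _ _ ε ⟩
          κ x y p q * ε - κ y x q p * ε ∎
          where
          ba : Commute b a
          ba = h-commute cy cx refl
          aa-bb : Commute (a * a) (b * b)
          aa-bb = commute-* (sym (commute-* ba ba)) (sym (commute-* ba ba))

        B₂-palindromes-commute : κ x y p q ≈ κ y x q p → Commute (a * h R p r * a) (b * h R q r * b)
        B₂-palindromes-commute κ-sym = commutator≈0⇒commute (begin
          [ a * h R p r * a , b * h R q r * b ]   ≈⟨ commutator-B₂-palindromes ⟩
          κ x y p q * ε - κ y x q p * ε           ≈⟨ +-congʳ (*-congʳ κ-sym) ⟩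
          κ y x q p * ε - κ y x q p * ε           ≈⟨ -‿inverseʳ _ ⟩
          0#                                      ∎)

    module _ {x y} (cx : Central R x) (cy : Central R y) where
      open import Algebra.Solver.Ring.NaturalCoefficients.Default centre

      κ-symmetric-B : κ x y x y ≈ κ y x y x
      κ-symmetric-B = solve 3 (λ x y b → y :* ((x :+ x :+ x :* x :* b) :* (con 1 :+ b :* y)) :+ x :* (y :* (b :* x))
                                      := x :* ((y :+ y :+ y :* y :* b) :* (con 1 :+ b :* x)) :+ y :* (x :* (b :* y)))
                              refl (x , cx) (y , cy) (β , cβ)

      κ-symmetric-C : κ x y (x ⊕ x) (y ⊕ y) ≈ κ y x (y ⊕ y) (x ⊕ x)
      κ-symmetric-C = solve 3 (λ x y b → (y :+ y :+ y :* y :* b) :* ((x :+ x :+ x :* x :* b) :* (con 1 :+ b :* y))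
                                           :+ (x :+ x :+ x :* x :* b) :* ((y :+ y :+ y :* y :* b) :* (b :* x))
                                      := (x :+ x :+ x :* x :* b) :* ((y :+ y :+ y :* y :* b) :* (con 1 :+ b :* x))
                                           :+ (y :+ y :+ y :* y :* b) :* ((x :+ x :+ x :* x :* b) :* (b :* y)))
                              refl (x , cx) (y , cy) (β , cβ)

    module _ {n u} (I : IsIdA R β n u) where
      open IsIdA I

      private
        top-bound : ∀ s k → s +ℕ suc (suc k) ≤ n → suc (s +ℕ k) < n
        top-bound s k = P.subst (_≤ n) (P.trans (+-suc s (suc k)) (P.cong suc (+-suc s k)))

        top<n : ∀ s k → s +ℕ suc (suc k) ≤ n → s +ℕ suc k < n
        top<n s k le = P.subst (_< n) (P.sym (+-suc s k)) (top-bound s k le)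

      top-pair : ∀ {s k} → 1 ≤ s → s +ℕ suc (suc k) ≤ n → IsIdA₂ (u (s +ℕ suc k)) (u (s +ℕ k))
      top-pair {s} {k} 1≤s le = P.subst (λ m → IsIdA₂ (u m) (u (s +ℕ k))) (P.sym (+-suc s k)) (record
        { idem-v = idemA (suc (s +ℕ k)) (s≤s z≤n) (top-bound s k le)
        ; idem-w = idemA (s +ℕ k) 1≤s+k (<⇒≤ (top-bound s k le))
        ; braid  = sym (braidA (s +ℕ k) 1≤s+k (top-bound s k le)) })
        where
        1≤s+k : 1 ≤ s +ℕ k
        1≤s+k = ≤-trans 1≤s (m≤m+n s k)

      top-commutes : ∀ {s k} → 1 ≤ s → s +ℕ suc (suc k) ≤ n → ∀ j → j < k → Commute (u (s +ℕ suc k)) (u (s +ℕ j))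
      top-commutes {s} {k} 1≤s le j j<k =
        sym (commA (s +ℕ j) (s +ℕ suc k) (≤-trans 1≤s (m≤m+n s j)) gap
                   (top<n s k le))
        where
        gap : 2 +ℕ (s +ℕ j) ≤ s +ℕ suc k
        gap = P.subst (_≤ s +ℕ suc k) (P.trans (+-suc s (suc j)) (P.cong suc (+-suc s j))) (+-monoʳ-≤ s (s≤s j<k))

      descs-commute : ∀ {s x y} → 1 ≤ s → Central R x → Central R y → ∀ k → s +ℕ k ≤ n →
                      Commute (desc R (λ j → h R x (u j)) s k) (desc R (λ j → h R y (u j)) s k)
      descs-commute 1≤s cx cy zero    le = refl
      descs-commute 1≤s cx cy (suc zero) le =
        commute-resp (sym (*-identityʳ _)) (sym (*-identityʳ _)) (h-commute cx cy refl)
      descs-commute {s} {x} {y} 1≤s cx cy (suc (suc k)) le =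
        descs-commute-step (top-pair 1≤s le) cx cy (lower-commutes cx) (lower-commutes cy)
          (descs-commute 1≤s cx cy (suc k) (≤-trans (+-monoʳ-≤ s (n≤1+n (suc k))) le))
        where
        lower-commutes : ∀ {z} → Central R z → Commute (desc R (λ j → h R z (u j)) s k) (u (s +ℕ suc k))
        lower-commutes cz = sym (commute-desc _ s k (λ j j<k → commute-h cz (top-commutes 1≤s le j j<k)))

      palindromes-commute : ∀ {s x y zx zy} → 1 ≤ s → Central R x → Central R y →
        (∀ j → s < j → j < n → Commute (u j) zx) → (∀ j → s < j → j < n → Commute (u j) zy) →
        Commute zx zy →
        (s < n → Commute (h R x (u s) * zx * h R x (u s)) (h R y (u s) * zy * h R y (u s))) →
        ∀ k → s +ℕ k ≤ n → Commute (palindrome (λ j → h R x (u j)) s k zx) (palindrome (λ j → h R y (u j)) s k zy)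
      palindromes-commute {s} {x} {y} {zx} {zy} 1≤s cx cy zx-comm zy-comm base₀ base₁ = go
        where
        fx fy : ℕ → Carrier
        fx j = h R x (u j)
        fy j = h R y (u j)
        go : ∀ k → s +ℕ k ≤ n → Commute (palindrome fx s k zx) (palindrome fy s k zy)
        go zero          le = commute-resp (sym (palindrome-zero fx s zx)) (sym (palindrome-zero fy s zy)) base₀
        go (suc zero)    le =
          commute-resp (sym (palindrome-one fx s zx)) (sym (palindrome-one fy s zy))
            (P.subst (λ m → Commute (h R x (u m) * zx * h R x (u m)) (h R y (u m) * zy * h R y (u m)))
                     (P.sym (+ℕ-identityʳ s)) (base₁ (P.subst (_≤ n) (+ℕ-comm s 1) le)))
        go (suc (suc k)) le =
          commute-resp (sym (peel₂ fx zx)) (sym (peel₂ fy zy))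
            (palindromes-commute-step (top-pair 1≤s le) cx cy (lower-commutes cx zx-comm) (lower-commutes cy zy-comm)
              (commute-resp (palindrome-suc fx s k zx) (palindrome-suc fy s k zy)
                (go (suc k) (≤-trans (+-monoʳ-≤ s (n≤1+n (suc k))) le))))
          where
          v : Carrier
          v = u (s +ℕ suc k)
          peel₂ : ∀ f z → palindrome f s (suc (suc k)) z ≈ f (s +ℕ suc k) * (f (s +ℕ k) * palindrome f s k z * f (s +ℕ k)) * f (s +ℕ suc k)
          peel₂ f z = trans (palindrome-suc f s (suc k) z) (*-congʳ (*-congˡ (palindrome-suc f s k z)))
          lower-commutes : ∀ {c z} → Central R c → (∀ j → s < j → j < n → Commute (u j) z) →
                           Commute (palindrome (λ j → h R c (u j)) s k z) v
          lower-commutes cc z-comm = sym (commute-palindrome _ s k _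
            (z-comm (s +ℕ suc k) (m<m+n s (s≤s z≤n)) (top<n s k le))
            (λ j j<k → commute-h cc (top-commutes 1≤s le j j<k)))

    Aop-commute : ∀ {n u} → IsIdA R β n u → ∀ {x y} → Central R x → Central R y → ∀ {i} → 1 ≤ i → i < n →
                  Commute (Aop R n i x u) (Aop R n i y u)
    Aop-commute {n} I cx cy {i} 1≤i i<n =
      descs-commute I 1≤i cx cy (n ∸ i) (P.subst (_≤ n) (P.sym (m+[n∸m]≡n (<⇒≤ i<n))) ≤-refl)

    module _ {x w} (cx : Central R x) (inv : IsInv1βx R β x w) where
      private
        cw : Central R w
        cw = central-inverse (central-+ central-1 (central-* cβ cx)) (proj₁ inv) (proj₂ inv)

      central-x̄ : Central R (- (x * w))
      central-x̄ = central-neg (central-* cx cw)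

      h-x-x̄ : ∀ {u} → u * u ≈ β * u → h R x u * h R (- (x * w)) u ≈ 1#
      h-x-x̄ uu = h-inverse uu cx cw (proj₂ inv)

    module _ {m u} (I : IsIdB R β (suc m) u) where
      open IsIdB I
      open IsIdA isIdA

      private
        u₀-commutes : ∀ {x} → Central R x → ∀ j → 1 < j → j < suc m → Commute (u j) (h R x (u 0))
        u₀-commutes cx j 1<j j<n = commute-h cx (sym (comm0 j 1<j j<n))

        B₂-relations : 1 < suc m → IsIdB₂ (u 1) (u 0)
        B₂-relations 1<n = record { idem-t = idemA 1 (s≤s z≤n) 1<n ; idem-r = idem0 (s≤s z≤n) ; braid = braid01 1<n }

        idem-upper : ∀ j → j < m → u (suc j) * u (suc j) ≈ β * u (suc j)
        idem-upper j j<m = idemA (suc j) (s≤s z≤n) (s≤s j<m)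

      FB-commute : ∀ {x y} → Central R x → Central R y → Commute (FB R (suc m) x u) (FB R (suc m) y u)
      FB-commute cx cy = palindromes-commute isIdA (s≤s z≤n) cx cy (u₀-commutes cx) (u₀-commutes cy)
        (h-commute cx cy refl)
        (λ 1<n → B₂-palindromes-commute (B₂-relations 1<n) cx cy cx cy (κ-symmetric-B cx cy))
        m ≤-refl

      FC-commute : ∀ {x y} → Central R x → Central R y → Commute (FC R (suc m) x u) (FC R (suc m) y u)
      FC-commute {x} {y} cx cy = commute-resp (sym (FC-palindrome x)) (sym (FC-palindrome y))
        (palindromes-commute isIdA (s≤s z≤n) cx cy (core-commutes cx) (core-commutes cy)
          (commute-* (sym (commute-* h₀ h₀)) (sym (commute-* h₀ h₀)))
          -- h₀(x)² = h₀(x ⊕ x): the C₂ base case is the B₂ one with p = x ⊕ x.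
          (λ 1<n → commute-resp (*-congʳ (*-congˡ (sym (h-⊕ (idem0 (s≤s z≤n)) cx))))
                                (*-congʳ (*-congˡ (sym (h-⊕ (idem0 (s≤s z≤n)) cy))))
                     (B₂-palindromes-commute (B₂-relations 1<n) cx cy (central-⊕ cx cx) (central-⊕ cy cy) (κ-symmetric-C cx cy)))
          m ≤-refl)
        where
        h₀ : Commute (h R y (u 0)) (h R x (u 0))
        h₀ = h-commute cy cx refl
        FC-palindrome : ∀ z → FC R (suc m) z u ≈ palindrome (λ j → h R z (u j)) 1 m (h R z (u 0) * h R z (u 0))
        FC-palindrome z = *-congʳ (*-assoc _ _ _)
        core-commutes : ∀ {z} → Central R z → ∀ j → 1 < j → j < suc m → Commute (u j) (h R z (u 0) * h R z (u 0))
        core-commutes cz j 1<j j<n = commute-* (u₀-commutes cz j 1<j j<n) (u₀-commutes cz j 1<j j<n)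

      FB-inverse : ∀ {x w} → Central R x → IsInv1βx R β x w → FB R (suc m) x u * FB R (suc m) (- (x * w)) u ≈ 1#
      FB-inverse cx inv = palindrome-inverse _ _ 1 m (λ j j<m → h-x-x̄ cx inv (idem-upper j j<m)) (h-x-x̄ cx inv (idem0 (s≤s z≤n)))

      FC-inverse : ∀ {x w} → Central R x → IsInv1βx R β x w → FC R (suc m) x u * FC R (suc m) (- (x * w)) u ≈ 1#
      FC-inverse {x} {w} cx inv = trans (*-cong (*-congʳ (*-assoc _ _ _)) (*-congʳ (*-assoc _ _ _)))
        (palindrome-inverse _ _ 1 m (λ j j<m → h-x-x̄ cx inv (idem-upper j j<m))
          (product-inverse (h-commute cx (central-x̄ cx inv) refl) h₀x̄ h₀x̄))
        where
        h₀x̄ : h R x (u 0) * h R (- (x * w)) (u 0) ≈ 1#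
        h₀x̄ = h-x-x̄ cx inv (idem0 (s≤s z≤n))

    module _ {m u uh} (I : IsIdD R β (suc (suc m)) u uh) where
      open IsIdD I
      open IsIdA isIdA

      private
        core-commutes : ∀ {x} → Central R x → ∀ j → 2 < j → j < suc (suc m) → Commute (u j) (h R x (u 1) * h R x uh)
        core-commutes cx j 2<j j<n =
          commute-* (commute-h cx (sym (commA 1 j (s≤s z≤n) 2<j j<n))) (commute-h cx (sym (commh j 2<j j<n)))

        u₁-uh : Commute (u 1) uh
        u₁-uh = sym (commh1 (s≤s (s≤s z≤n)))

        D₃-relation : 2 < suc (suc m) → IsIdA₂ (u 2) uh
        D₃-relation 2<n = record { idem-v = idemA 2 (s≤s z≤n) 2<n ; idem-w = idemh ; braid = sym (braidh2 2<n) }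

        idem-upper : ∀ j → j < m → u (2 +ℕ j) * u (2 +ℕ j) ≈ β * u (2 +ℕ j)
        idem-upper j j<m = idemA (2 +ℕ j) (s≤s z≤n) (s≤s (s≤s j<m))

        FD-palindrome : ∀ z → FD R (suc (suc m)) z u uh ≈ palindrome (λ j → h R z (u j)) 2 m (h R z (u 1) * h R z uh)
        FD-palindrome z = *-congʳ (*-assoc _ _ _)

      FD-commute : ∀ {x y} → Central R x → Central R y → Commute (FD R (suc (suc m)) x u uh) (FD R (suc (suc m)) y u uh)
      FD-commute {x} {y} cx cy = commute-resp (sym (FD-palindrome x)) (sym (FD-palindrome y))
        (palindromes-commute isIdA (s≤s z≤n) cx cy (core-commutes cx) (core-commutes cy) base₀
          (λ 2<n → forks-commute (top-pair isIdA {1} {0} (s≤s z≤n) 2<n) (D₃-relation 2<n) u₁-uh cx cy)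
          m ≤-refl)
        where
        base₀ : Commute (h R x (u 1) * h R x uh) (h R y (u 1) * h R y uh)
        base₀ = commute-* (sym (commute-* (h-commute cy cx refl) (h-commute cy cx u₁-uh)))
                          (sym (commute-* (h-commute cy cx (sym u₁-uh)) (h-commute cy cx refl)))

      FD-inverse : ∀ {x w} → Central R x → IsInv1βx R β x w → FD R (suc (suc m)) x u uh * FD R (suc (suc m)) (- (x * w)) u uh ≈ 1#
      FD-inverse cx inv = trans (*-cong (FD-palindrome _) (FD-palindrome _))
        (palindrome-inverse _ _ 2 m (λ j j<m → h-x-x̄ cx inv (idem-upper j j<m))
          (product-inverse (h-commute cx (central-x̄ cx inv) (sym u₁-uh))
                           (h-x-x̄ cx inv (idemA 1 (s≤s z≤n) (s≤s (s≤s z≤n)))) (h-x-x̄ cx inv idemh)))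

lemma3 : ∀ {c ℓ} (R : Ring c ℓ) → let open Ring R in
    (β : Carrier) → Central R β →
    -- (1) type A
    (∀ (n : ℕ) (u : ℕ → Carrier) → IsIdA R β n u →
       ∀ x y → Central R x → Central R y → ∀ i → 1 ≤ i → i < n →
       Aop R n i x u * Aop R n i y u ≈ Aop R n i y u * Aop R n i x u)
    -- (2),(3) type B
    × (∀ (n : ℕ) (u : ℕ → Carrier) → 1 ≤ n → IsIdB R β n u →
       (∀ x y → Central R x → Central R y →
          FB R n x u * FB R n y u ≈ FB R n y u * FB R n x u)
       × (∀ x w → Central R x → IsInv1βx R β x w →
          FB R n x u * FB R n (- (x * w)) u ≈ 1#))
    -- (2),(3) type C
    × (∀ (n : ℕ) (u : ℕ → Carrier) → 1 ≤ n → IsIdB R β n u →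
       (∀ x y → Central R x → Central R y →
          FC R n x u * FC R n y u ≈ FC R n y u * FC R n x u)
       × (∀ x w → Central R x → IsInv1βx R β x w →
          FC R n x u * FC R n (- (x * w)) u ≈ 1#))
    -- (2),(3) type D
    × (∀ (n : ℕ) (u : ℕ → Carrier) (uh : Carrier) → 2 ≤ n → IsIdD R β n u uh →
       (∀ x y → Central R x → Central R y →
          FD R n x u uh * FD R n y u uh ≈ FD R n y u uh * FD R n x u uh)
       × (∀ x w → Central R x → IsInv1βx R β x w →
          FD R n x u uh * FD R n (- (x * w)) u uh ≈ 1#))
lemma3 R β cβ =
    (λ n u I x y cx cy i 1≤i i<n → Aop-commute I cx cy 1≤i i<n)
  , (λ { (suc m) u _ I → (λ x y → FB-commute I) , (λ x w → FB-inverse I) })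
  , (λ { (suc m) u _ I → (λ x y → FC-commute I) , (λ x w → FC-inverse I) })
  , (λ { (suc zero) _ _ (s≤s ()) _ ; (suc (suc m)) u uh _ I → (λ x y → FD-commute I) , (λ x w → FD-inverse I) })
  where
  open InRing R
  open IdCoxeter β cβ
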